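{- Let $G$ be a graph and $S,T\subseteq V(G)$, and let $\partial(S)$ denote the set of vertices of $S$ having a neighbor in $V(G)\setminus S$. Let $H$ be a graph with $\partial(S)\cup(T\cap S)\subseteq V(H)$ and $V(H)\cap(V(G)\setminus S)=\emptyset$, such that $B_H(\partial(S)\cup(T\cap S))=B_{G[S]}(\partial(S)\cup(T\cap S))$. Let $G'$ be obtained from $G$ by replacing $G[S]$ by $H$: $V(G')=(V(G)\setminus S)\cup V(H)$ and $E(G')$ consists of the edges of $G$ having at least one endpoint outside $S$ together with $E(H)$. Then $B_G(T)=B_{G'}(T)$.
   Context: For a graph $F$ and $X\subseteq V(F)$, $B_F(X)$ is the set of all subsets $X'\subseteq X$ such that some proper $2$-coloring of $F$ gives all vertices of $X'$ one color and all vertices of $X\setminus X'$ the other color (so $B_F(X)=\emptyset$ if $F$ is not bipartite). -}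

module Defs where

open import Data.Nat using (ℕ)
open import Data.Fin using (Fin)
open import Data.Fin.Subset using (Subset; _∈_; _∉_; _∩_)
open import Data.Bool using (Bool; not)
open import Data.Product using (Σ; _×_; _,_; ∃)
open import Data.Sum using (_⊎_; inj₁; inj₂)
open import Relation.Nullary using (¬_)
open import Relation.Binary.PropositionalEquality using (_≡_; _≢_)
open import Function.Bundles using (_⇔_)

-- V is the vertex set; E is the edge relation,
-- which is only relevant between vertices of V (see Adj).
record Graph (n : ℕ) : Set₁ where
  field
    V      : Subset n
    E      : Fin n → Fin n → Set
    E-sym  : ∀ {u v} → E u v → E v u
    E-irr  : ∀ {u} → ¬ E u u
open Graph public

PSet : ℕ → Set₁
PSet n = Fin n → Set

Adj : ∀ {n} → Graph n → Fin n → Fin n → Set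
Adj F u v = u ∈ V F × v ∈ V F × E F u v

Proper : ∀ {n} → Graph n → (Fin n → Bool) → Set
Proper F c = ∀ u v → Adj F u v → c u ≢ c v

B : ∀ {n : ℕ} → Graph n → PSet n → PSet n → Set
B {n} F X X' =
  (∀ x → X' x → X x) ×
  Σ (Fin n → Bool) λ c → Proper F c ×
    Σ Bool λ b → (∀ x → X' x → c x ≡ b) ×
                 (∀ x → X x → ¬ X' x → c x ≡ not b)

SameB : ∀ {n : ℕ} → Graph n → PSet n → Graph n → PSet n → Set₁
SameB {n} F X F' Y = ∀ (X' : PSet n) → B F X X' ⇔ B F' Y X'

induced : ∀ {n} → Graph n → Subset n → Graph n
induced G S = record
  { V = V G ∩ S
  ; E = λ u v → E G u v × u ∈ S × v ∈ S
  ; E-sym = λ { (e , p , q) → E-sym G e , q , p }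
  ; E-irr = λ { (e , _ , _) → E-irr G e }
  }

boundary : ∀ {n} → Graph n → Subset n → PSet n
boundary G S x = x ∈ S × ∃ λ v → Adj G x v × v ∉ S

DS : ∀ {n} → Graph n → Subset n → Subset n → PSet n
DS G S T x = boundary G S x ⊎ (x ∈ T × x ∈ S)

replace : ∀ {n} → Graph n → Subset n → Graph n → Graph n
replace {n} G S H = record
  { V = Data.Fin.Subset._∪_ (V G ∩ Data.Fin.Subset.∁ S) (V H)
  ; E = E'
  ; E-sym = sym'
  ; E-irr = irr'
  }
  where
  E' : Fin n → Fin n → Set
  E' u v = (Adj G u v × (u ∉ S ⊎ v ∉ S)) ⊎ Adj H u v
  sym' : ∀ {u v} → E' u v → E' v u
  sym' (inj₁ ((p , q , e) , inj₁ a)) = inj₁ ((q , p , E-sym G e) , inj₂ a)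
  sym' (inj₁ ((p , q , e) , inj₂ a)) = inj₁ ((q , p , E-sym G e) , inj₁ a)
  sym' (inj₂ (p , q , e)) = inj₂ (q , p , E-sym H e)
  irr' : ∀ {u} → ¬ E' u u
  irr' (inj₁ ((_ , _ , e) , _)) = E-irr G e
  irr' (inj₂ (_ , _ , e)) = E-irr H e

-- A proper 2-colouring of either graph can be rebuilt into one of the other
-- with the same colours on T.  Keep it outside S (only crossing edges of G
-- join the two parts, and their ends in S lie in ∂(S)), and inside S replace
-- it by a proper colouring of H resp. G[S] with the same colours on
-- ∂(S) ∪ (T ∩ S); such a colouring exists because B_H and B_G[S] agree there,
-- after possibly swapping its two colours.
module Submission where

open import Defs
open import Data.Nat using (ℕ)
open import Data.Fin using (Fin)
open import Data.Fin.Subset using (Subset; _∈_; _∉_; _⊆_)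
open import Data.Fin.Subset.Properties using (_∈?_; x∈p∩q⁺; x∈p∩q⁻; x∈p∪q⁺; x∉p⇒x∈∁p)
open import Data.Empty using (⊥; ⊥-elim)
open import Data.Bool using (Bool; true; false; not; _≟_)
open import Data.Bool.Properties using (¬-not; not-injective)
open import Data.Product using (_×_; _,_; ∃; proj₁; proj₂)
open import Data.Sum using (_⊎_; inj₁; inj₂)
open import Function using (_∘_)
open import Relation.Nullary using (Dec; yes; no)
open import Relation.Binary.PropositionalEquality using (_≡_; _≢_; refl; sym; trans; cong)
open import Function.Bundles using (mk⇔; Equivalence)
import Function.Properties.Equivalence as ⇔

private
  variable
    n : ℕ

AgreeOn : PSet n → (Fin n → Bool) → (Fin n → Bool) → Set
AgreeOn X c c' = ∀ x → X x → c x ≡ c' x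

record Transfers (F F' : Graph n) (X : PSet n) : Set where
  field
    transfer : ∀ c → Proper F c → ∃ λ c' → Proper F' c' × AgreeOn X c' c
open Transfers

B-transfer : ∀ {F F' : Graph n} {X} → Transfers F F' X →
             ∀ X' → B F X X' → B F' X X'
B-transfer tr X' (X'⊆X , c , pc , b , inX' , outX') with transfer tr c pc
... | c' , pc' , agree =
  X'⊆X , c' , pc' , b ,
  (λ x x∈X' → trans (agree x (X'⊆X x x∈X')) (inX' x x∈X')) ,
  (λ x x∈X x∉X' → trans (agree x x∈X) (outX' x x∈X x∉X'))

Transfers⇒SameB : ∀ {F F' : Graph n} {X} →
                  Transfers F F' X → Transfers F' F X → SameB F X F' X
Transfers⇒SameB tr tr' X' = mk⇔ (B-transfer tr X') (B-transfer tr' X')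

Proper-not : ∀ (F : Graph n) {c} → Proper F c → Proper F (not ∘ c)
Proper-not F pc u v uv = pc u v uv ∘ not-injective

colourClass : (Fin n → Bool) → PSet n → PSet n
colourClass c X x = X x × c x ≡ true

colourClass∈B : ∀ (F : Graph n) {c} X → Proper F c → B F X (colourClass c X)
colourClass∈B F X pc =
  (λ _ → proj₁) , _ , pc , true , (λ _ → proj₂) ,
  λ _ x∈X x∉class → ¬-not (λ cx≡true → x∉class (x∈X , cx≡true))

-- The colouring of F' realising the colour class of c may use the colours
-- the other way round; composing it with `not` then fixes it.
SameB⇒Transfers : ∀ F F' {X : PSet n} → SameB F X F' X → Transfers F F' X
transfer (SameB⇒Transfers F F' {X} same) c pc
  with Equivalence.to (same (colourClass c X)) (colourClass∈B F X pc)
... | _ , c' , pc' , true , inClass , outClass = c' , pc' , agree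
  where
  agree : AgreeOn X c' c
  agree x x∈X with c x ≟ true
  ... | yes cx≡true = trans (inClass x (x∈X , cx≡true)) (sym cx≡true)
  ... | no  cx≢true = trans (outClass x x∈X (cx≢true ∘ proj₂)) (sym (¬-not cx≢true))
... | _ , c' , pc' , false , inClass , outClass = not ∘ c' , Proper-not F' pc' , agree
  where
  agree : AgreeOn X (not ∘ c') c
  agree x x∈X with c x ≟ true
  ... | yes cx≡true = trans (cong not (inClass x (x∈X , cx≡true))) (sym cx≡true)
  ... | no  cx≢true =
    trans (cong not (outClass x x∈X (cx≢true ∘ proj₂))) (sym (¬-not cx≢true))

Proper-induced : ∀ (G : Graph n) S {c} → Proper G c → Proper (induced G S) c
Proper-induced G S pc u v (u∈G∩S , v∈G∩S , e , _) =
  pc u v (proj₁ (x∈p∩q⁻ _ _ u∈G∩S) , proj₁ (x∈p∩q⁻ _ _ v∈G∩S) , e)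

Proper-replaced : ∀ (G H : Graph n) S {c} → Proper (replace G S H) c → Proper H c
Proper-replaced G H S pc u v uv@(u∈H , v∈H , _) =
  pc u v (x∈p∪q⁺ (inj₂ u∈H) , x∈p∪q⁺ (inj₂ v∈H) , inj₂ uv)

select : Subset n → (Fin n → Bool) → (Fin n → Bool) → Fin n → Bool
select P f g x with x ∈? P
... | yes _ = f x
... | no  _ = g x

select-∈ : ∀ P f g {x : Fin n} → x ∈ P → select P f g x ≡ f x
select-∈ P f g {x} x∈P with x ∈? P
... | yes _   = refl
... | no  x∉P = ⊥-elim (x∉P x∈P)

module Replacement
  (G H : Graph n) (S T : Subset n)
  (T⊆G : T ⊆ V G)
  (DS⊆H : ∀ x → DS G S T x → x ∈ V H)
  (H∩G⊆S : ∀ x → x ∈ V H → x ∈ V G → x ∉ S → ⊥)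
  where

  D : PSet n
  D = DS G S T

  G' : Graph n
  G' = replace G S H

  -- the vertices on which the colourings of G and G' are made to agree
  Shared : PSet n
  Shared x = x ∉ S ⊎ D x

  T-shared : ∀ {x} → x ∈ T → Shared x
  T-shared {x} x∈T with x ∈? S
  ... | yes x∈S = inj₂ (inj₂ (x∈T , x∈S))
  ... | no  x∉S = inj₁ x∉S

  crossing-shared : ∀ {u v} → Adj G u v → v ∉ S → Shared u
  crossing-shared {u} {v} uv v∉S with u ∈? S
  ... | yes u∈S = inj₂ (inj₁ (u∈S , v , uv , v∉S))
  ... | no  u∉S = inj₁ u∉S

  Shared-G' : ∀ {x} → x ∈ V G → Shared x → x ∈ V G'
  Shared-G' x∈G (inj₁ x∉S) = x∈p∪q⁺ (inj₁ (x∈p∩q⁺ (x∈G , x∉p⇒x∈∁p x∉S)))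
  Shared-G' {x} _ (inj₂ x∈D) = x∈p∪q⁺ (inj₂ (DS⊆H x x∈D))

  flip-Adj : ∀ {u v} → Adj G u v → Adj G v u
  flip-Adj (u∈G , v∈G , e) = v∈G , u∈G , E-sym G e

  crossing-Adj : ∀ {u v} → Adj G u v → u ∉ S ⊎ v ∉ S → Shared u → Shared v →
                 Adj G' u v
  crossing-Adj uv@(u∈G , v∈G , _) out su sv =
    Shared-G' u∈G su , Shared-G' v∈G sv , inj₁ (uv , out)

  forward : Transfers (induced G S) H D → Transfers G G' (λ x → x ∈ T)
  transfer (forward trS) c pc with transfer trS c (Proper-induced G S pc)
  ... | cH , pcH , cH≈c = c' , pc' , λ x x∈T → c'≈c (T⊆G x∈T) (T-shared x∈T)
    where
    c' : Fin n → Bool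
    c' = select (V H) cH c

    c'≈c : ∀ {x} → x ∈ V G → Shared x → c' x ≡ c x
    c'≈c {x} x∈G shared with x ∈? V H | shared
    ... | no  _   | _          = refl
    ... | yes x∈H | inj₁ x∉S  = ⊥-elim (H∩G⊆S x x∈H x∈G x∉S)
    ... | yes _   | inj₂ x∈D  = cH≈c x x∈D

    via-G : ∀ {u v} → Adj G u v → Shared u → Shared v → c' u ≡ c' v → ⊥
    via-G {u} {v} uv@(u∈G , v∈G , _) su sv eq =
      pc u v uv (trans (sym (c'≈c u∈G su)) (trans eq (c'≈c v∈G sv)))

    pc' : Proper G' c'
    pc' u v (_ , _ , inj₂ uv@(u∈H , v∈H , _)) eq =
      pcH u v uv (trans (sym (select-∈ (V H) cH c u∈H))
                        (trans eq (select-∈ (V H) cH c v∈H)))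
    pc' u v (_ , _ , inj₁ (uv , inj₁ u∉S)) =
      via-G uv (inj₁ u∉S) (crossing-shared (flip-Adj uv) u∉S)
    pc' u v (_ , _ , inj₁ (uv , inj₂ v∉S)) =
      via-G uv (crossing-shared uv v∉S) (inj₁ v∉S)

  backward : Transfers H (induced G S) D → Transfers G' G (λ x → x ∈ T)
  transfer (backward trH) c' pc' with transfer trH c' (Proper-replaced G H S pc')
  ... | cS , pcS , cS≈c' = c , pc , λ x x∈T → c≈c' (T-shared x∈T)
    where
    c : Fin n → Bool
    c = select S cS c'

    c≈c' : ∀ {x} → Shared x → c x ≡ c' x
    c≈c' {x} shared with x ∈? S | shared
    ... | no  _   | _          = refl
    ... | yes x∈S | inj₁ x∉S  = ⊥-elim (x∉S x∈S)
    ... | yes _   | inj₂ x∈D  = cS≈c' x x∈D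

    via-G' : ∀ {u v} → Adj G u v → u ∉ S ⊎ v ∉ S → Shared u → Shared v →
             c u ≡ c v → ⊥
    via-G' {u} {v} uv out su sv eq =
      pc' u v (crossing-Adj uv out su sv) (trans (sym (c≈c' su)) (trans eq (c≈c' sv)))

    pc : Proper G c
    pc u v uv@(u∈G , v∈G , e) = by-sides (u ∈? S) (v ∈? S)
      where
      by-sides : Dec (u ∈ S) → Dec (v ∈ S) → c u ≢ c v
      by-sides (yes u∈S) (yes v∈S) eq =
        pcS u v (x∈p∩q⁺ (u∈G , u∈S) , x∈p∩q⁺ (v∈G , v∈S) , e , u∈S , v∈S)
          (trans (sym (select-∈ S cS c' u∈S)) (trans eq (select-∈ S cS c' v∈S)))
      by-sides (yes _) (no v∉S) =
        via-G' uv (inj₂ v∉S) (crossing-shared uv v∉S) (inj₁ v∉S)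
      by-sides (no u∉S) _ =
        via-G' uv (inj₁ u∉S) (inj₁ u∉S) (crossing-shared (flip-Adj uv) u∉S)

lemma5 : ∀ {n : ℕ} (G H : Graph n) (S T : Subset n) →
    S ⊆ V G → T ⊆ V G →
    (∀ x → DS G S T x → x ∈ V H) →
    (∀ x → x ∈ V H → x ∈ V G → x ∉ S → ⊥) →
    SameB H (DS G S T) (induced G S) (DS G S T) →
    SameB G (λ x → x ∈ T) (replace G S H) (λ x → x ∈ T)
lemma5 G H S T _ T⊆G DS⊆H H∩G⊆S same =
  Transfers⇒SameB (forward (SameB⇒Transfers (induced G S) H (⇔.sym ∘ same)))
                  (backward (SameB⇒Transfers H (induced G S) same))
  where open Replacement G H S T T⊆G DS⊆H H∩G⊆S
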